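{- Let $G=(V,E)$ be a graph with vertex set $V=\{1,\dots,n\}$ and let $m\ge 1$. Then $M(G)$ is the intersection of at most $m$ matroids on $E$ if and only if there exist values $x^a_{ij,ik}\in\{0,1\}$, for all $a\in\{1,\dots,m\}$ and all vertices $i,j,k$ with $ij,ik\in E$, $j<k$ (with the convention $x^a_{ik,ij}:=x^a_{ij,ik}$), satisfying all of the following: (i) (cover) $\sum_{a=1}^m x^a_{ij,ik}\ge 1$ for all $ij,ik\in E$ with $j<k$; (ii) (claw) for all $a$ and all distinct $i,j,k,l$ with $ij,ik,il\in E$: $x^a_{ij,ik}+x^a_{ij,il}-x^a_{ik,il}\le 1$, $x^a_{ij,ik}-x^a_{ij,il}+x^a_{ik,il}\le 1$, and $-x^a_{ij,ik}+x^a_{ij,il}+x^a_{ik,il}\le 1$; (iii) (triangle) for all $a$ and all distinct $i,j,k$ with $ij,ik,jk\in E$: $x^a_{ij,ik}+x^a_{ji,jk}-x^a_{ki,kj}\le 1$, $x^a_{ij,ik}-x^a_{ji,jk}+x^a_{ki,kj}\le 1$, and $-x^a_{ij,ik}+x^a_{ji,jk}+x^a_{ki,kj}\le 1$; (iv) (matching) for all $a$ and all distinct vertices $i,j,k,l$ with $ij,ik,kl\in E$: $x^a_{ij,ik}+x^a_{ki,kl}\le 1$.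
   Context: Graphs are finite, undirected, without loops or multiple edges; the edge with endpoints $i,j$ is written $ij=ji$. A matroid on a finite set $S$ is a family $\mathcal{M}$ of subsets of $S$ with $\emptyset\in\mathcal{M}$, closed under subsets, such that for every $A\subseteq S$ all maximal members of $\mathcal{M}$ contained in $A$ have the same cardinality. $M(G)$ denotes the family of all matchings of $G$ (sets of pairwise disjoint edges), as a family of subsets of $E$. The intersection of matroids $\mathcal{M}_1,\dots,\mathcal{M}_m$ on $E$ is $\mathcal{M}_1\cap\dots\cap\mathcal{M}_m$. -}

module Defs where

open import Data.Bool using (Bool; true; false; T; _∧_; if_then_else_)
open import Data.Nat using (ℕ; zero; suc; _+_; _≤_; _<ᵇ_)
open import Data.Fin using (Fin; toℕ; _<_)
open import Data.List using (List; map; allFin)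
open import Data.Nat.ListAction using (sum)
open import Data.Product using (Σ; _×_; _,_; proj₁; proj₂)
open import Data.Unit using (tt)
open import Relation.Binary.PropositionalEquality using (_≡_; _≢_)
open import Function.Bundles using (_⇔_)

-- A finite simple graph on the vertex set Fin n (≅ {1,…,n}, order preserved):
-- symmetric, loopless adjacency.
record Graph (n : ℕ) : Set where
  field
    adj   : Fin n → Fin n → Bool
    adj-sym : ∀ i j → adj i j ≡ adj j i
    adj-irr : ∀ i → adj i i ≡ false
open Graph public

_<ᶠ_ : ∀ {n} → Fin n → Fin n → Bool
i <ᶠ j = toℕ i <ᵇ toℕ j

-- An edge {i,j} of G is represented uniquely as (i , j , _) with i < j.
-- The proof component lives in T (…) = ⊤, so it is definitionally unique.
Edge : ∀ {n} → Graph n → Set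
Edge {n} G = Σ (Fin n) λ i → Σ (Fin n) λ j → T ((i <ᶠ j) ∧ adj G i j)

private
  count : (b : Bool) → (T b → Bool) → ℕ
  count true f = if f tt then 1 else 0
  count false f = 0

module OnGraph {n} (G : Graph n) where
  fst snd : Edge G → Fin n
  fst e = proj₁ e
  snd e = proj₁ (proj₂ e)

  -- Subsets of E (finite, hence decidable) and families of subsets of E.
  ESubset : Set
  ESubset = Edge G → Bool

  Family : Set
  Family = ESubset → Bool

  _⊆_ : ESubset → ESubset → Set
  S ⊆ T′ = ∀ e → S e ≡ true → T′ e ≡ true

  ∅ : ESubset
  ∅ _ = false

  card : ESubset → ℕ
  card S =
    sum (map (λ i → sum (map (λ j → count ((i <ᶠ j) ∧ adj G i j) (λ p → S (i , j , p)))
                             (allFin n)))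
             (allFin n))

  MaximalIn : Family → ESubset → ESubset → Set
  MaximalIn ℳ A B =
    ℳ B ≡ true × B ⊆ A × (∀ D → B ⊆ D → D ⊆ A → ℳ D ≡ true → D ⊆ B)

  record IsMatroid (ℳ : Family) : Set where
    field
      empty∈ : ℳ ∅ ≡ true
      down-closed : ∀ S T′ → S ⊆ T′ → ℳ T′ ≡ true → ℳ S ≡ true
      equicard : ∀ A B C → MaximalIn ℳ A B → MaximalIn ℳ A C → card B ≡ card C

  Shares : Edge G → Edge G → Set
  Shares e f = (fst e ≡ fst f) Data.Sum.⊎ (fst e ≡ snd f) Data.Sum.⊎ (snd e ≡ fst f) Data.Sum.⊎ (snd e ≡ snd f)
    where import Data.Sum

  IsMatching : ESubset → Set
  IsMatching S = ∀ e f → S e ≡ true → S f ≡ true → Shares e f → e ≡ f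


open OnGraph public

IntersectionOfAtMost : ∀ {n} (G : Graph n) (m : ℕ) → Set
IntersectionOfAtMost G m =
  Σ ℕ λ k → k ≤ m × Σ (Fin k → Family G) λ ℳ →
    (∀ a → IsMatroid G (ℳ a)) × (∀ S → IsMatching G S ⇔ (∀ a → ℳ a S ≡ true))

-- 0/1 values: x a i j k stands for x^a_{ij,ik}; only the entries with j < k are
-- used, the others are given by the convention x^a_{ik,ij} := x^a_{ij,ik}.
Vars : ℕ → ℕ → Set
Vars m n = Fin m → Fin n → Fin n → Fin n → Bool

b2n : Bool → ℕ
b2n true = 1
b2n false = 0

val : ∀ {m n} → Vars m n → Fin m → Fin n → Fin n → Fin n → ℕ
val x a i j k = b2n (if j <ᶠ k then x a i j k else x a i k j)

ΣFin : (m : ℕ) → (Fin m → ℕ) → ℕ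
ΣFin m f = sum (map f (allFin m))

E? : ∀ {n} → Graph n → Fin n → Fin n → Set
E? G i j = adj G i j ≡ true

Cover : ∀ {m n} → Graph n → Vars m n → Set
Cover {m} G x = ∀ i j k → E? G i j → E? G i k → j < k → 1 ≤ ΣFin m (λ a → val x a i j k)

-- a + b - c ≤ 1 written as a + b ≤ 1 + c (natural numbers)
Three : ℕ → ℕ → ℕ → Set
Three p q r = (p + q ≤ 1 + r) × (p + r ≤ 1 + q) × (q + r ≤ 1 + p)

Claw : ∀ {m n} → Graph n → Vars m n → Set
Claw G x = ∀ a i j k l → i ≢ j → i ≢ k → i ≢ l → j ≢ k → j ≢ l → k ≢ l →
  E? G i j → E? G i k → E? G i l →
  Three (val x a i j k) (val x a i j l) (val x a i k l)

Triangle : ∀ {m n} → Graph n → Vars m n → Set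
Triangle G x = ∀ a i j k → i ≢ j → i ≢ k → j ≢ k →
  E? G i j → E? G i k → E? G j k →
  Three (val x a i j k) (val x a j i k) (val x a k i j)

MatchingC : ∀ {m n} → Graph n → Vars m n → Set
MatchingC G x = ∀ a i j k l → i ≢ j → i ≢ k → i ≢ l → j ≢ k → j ≢ l → k ≢ l →
  E? G i j → E? G i k → E? G k l →
  val x a i j k + val x a k i l ≤ 1

-- Given a solution x, for each colour a let e ∥ₐ f hold when e = ij, f = ik and x^a_{ij,ik} = 1.
-- Equality or ∥ₐ is an equivalence relation: the claw, triangle and matching inequalities are
-- exactly transitivity for the three ways in which ij ∥ₐ ik and ik ∥ₐ g can chain (g meeting ik
-- at i, at k with g = kj, or at k with g = kl). The partition matroid of this relation (at most
-- one edge per class) is a matroid, and by the cover condition a set is independent in all m of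
-- them iff no two of its edges meet.
-- Conversely, pad the matroids with free matroids up to m and let x^a_{ij,ik} = 1 iff {ij, ik}
-- is dependent in the a-th one. Since singletons are matchings, dependence of pairs is transitive
-- on distinct edges: if {e,f} and {e,g} are dependent but {f,g} is not, then {e} and {f,g} are
-- maximal independent subsets of {e,f,g} of different sizes. This gives the claw and triangle
-- inequalities, and, with independence of the matching {ij, kl}, the matching inequality; cover
-- holds because {ij, ik} is not a matching.
module Submission where

open import Defs
  hiding (ESubset; Family; _⊆_; ∅; card; MaximalIn; IsMatroid; Shares; IsMatching; fst; snd)

open import Data.Bool using (Bool; true; false; T; not; _∧_; _∨_)
import Data.Bool as Bool
open import Data.Bool.Properties
  using (T-irrelevant; ∨-comm; ∨-zeroʳ; T-≡; T-∧; ⇔→≡; not-injective; ¬-not; not-¬)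
open import Data.Empty using (⊥; ⊥-elim)
open import Data.Fin using (Fin; toℕ; fromℕ<; inject≤)
import Data.Fin as Fin
open import Data.Fin.Properties
  using (<-cmp; toℕ-injective; any?; ¬∀⟶∃¬; <⇒≢; toℕ<n; toℕ-inject≤; fromℕ<-cong; fromℕ<-toℕ)
open import Data.List using (List; []; _∷_; length; map; filter; concatMap; allFin)
open import Data.List.Properties using (filter-++; length-++; length-removeAt′; map-cong)
open import Data.List.Membership.Propositional using (_∈_; lose)
open import Data.List.Membership.Propositional.Properties
  using (∈-concatMap⁺; ∈-concatMap⁻; ∈-allFin; ∈-filter⁺; ∈-filter⁻)
open import Data.List.Relation.Binary.Disjoint.Propositional using (Disjoint)
open import Data.List.Relation.Unary.All as All using (All; []; _∷_)
open import Data.List.Relation.Unary.AllPairs using ([]; _∷_)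
open import Data.List.Relation.Unary.Any as Any using (here; there; _─_)
open import Data.List.Relation.Unary.Unique.Propositional using (Unique)
open import Data.List.Relation.Unary.Unique.Propositional.Properties using (++⁺; allFin⁺; filter⁺)
open import Data.Nat using (ℕ; zero; suc; _+_; _≤_; _<_; _<?_; z≤n; s≤s; z<s)
import Data.Nat as ℕ
open import Data.Nat.ListAction using (sum)
open import Data.Nat.Properties
  using ( ≤-refl; ≤-trans; ≤-reflexive; ≤-antisym; <-asym; <-irrefl; ≮⇒≥; m≤m+n; m≤n+m
        ; +-identityʳ; <ᵇ⇒<; <⇒<ᵇ; module ≤-Reasoning)
open import Data.Product using (Σ; ∃; _×_; _,_; proj₁; proj₂)
open import Data.Product.Properties using (≡-dec)
open import Data.Sum using (_⊎_; inj₁; inj₂)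
open import Function using (_∘_)
open import Function.Bundles using (Equivalence; mk⇔; _⇔_)
open import Level using (0ℓ)
open import Relation.Binary using (Setoid; Rel; IsEquivalence; DecidableEquality; tri<; tri≈; tri>)
open import Relation.Binary.PropositionalEquality
  using (_≡_; _≢_; refl; sym; trans; cong; cong₂; subst; subst₂; module ≡-Reasoning)
import Relation.Binary.PropositionalEquality as ≡
open import Relation.Nullary using (¬_; Dec; yes; no; does)
open import Relation.Nullary.Decidable
  using (¬?; _×-dec_; _⊎-dec_; _→-dec_; dec-true; does-⇔; map′)
open import Relation.Unary using (Pred; Decidable)

module _ {a ℓ} (S : Setoid a ℓ) where
  open Setoid S using (_≈_) renaming (sym to ≈-sym; trans to ≈-trans)
  open import Data.List.Membership.Setoid S using () renaming (_∈_ to _∈ₛ_)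
  open import Data.List.Relation.Unary.Unique.Setoid S using () renaming (Unique to Uniqueₛ)

  private
    ∈-─ : ∀ {x y ys} (p : x ∈ₛ ys) → y ∈ₛ ys → ¬ y ≈ x → y ∈ₛ (ys ─ p)
    ∈-─ (here x≈z) (here y≈z) y≉x = ⊥-elim (y≉x (≈-trans y≈z (≈-sym x≈z)))
    ∈-─ (here _)   (there q)  _   = q
    ∈-─ (there _)  (here y≈z) _   = here y≈z
    ∈-─ (there p)  (there q)  y≉x = there (∈-─ p q y≉x)

  Unique⇒Uniqueₛ : ∀ {xs} → Unique xs → (∀ {x y} → x ∈ xs → y ∈ xs → x ≈ y → x ≡ y) → Uniqueₛ xs
  Unique⇒Uniqueₛ {[]}     []           _   = []
  Unique⇒Uniqueₛ {x ∷ xs} (x∉xs ∷ xs!) ≈⇒≡ =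
    All.tabulate (λ y∈xs x≈y → All.lookup x∉xs y∈xs (≈⇒≡ (here refl) (there y∈xs) x≈y))
    ∷ Unique⇒Uniqueₛ xs! (λ x∈ y∈ → ≈⇒≡ (there x∈) (there y∈))

  Unique-length-≤ : ∀ {xs ys} → Uniqueₛ xs → All (_∈ₛ ys) xs → length xs ≤ length ys
  Unique-length-≤ {[]}          _            _              = z≤n
  Unique-length-≤ {x ∷ xs} {ys} (x≉xs ∷ xs!) (x∈ys ∷ xs⊆ys) = ≤-trans
    (s≤s (Unique-length-≤ xs!
      (All.zipWith (λ (y∈ys , x≉y) → ∈-─ x∈ys y∈ys (x≉y ∘ ≈-sym)) (xs⊆ys , x≉xs))))
    (≤-reflexive (sym (length-removeAt′ ys (Any.index x∈ys))))

module _ {a b p} {A : Set a} {B : Set b} {P : Pred B p} (P? : Decidable P) (f : A → List B) where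

  length-filter-concatMap : ∀ xs →
    length (filter P? (concatMap f xs)) ≡ sum (map (λ x → length (filter P? (f x))) xs)
  length-filter-concatMap []       = refl
  length-filter-concatMap (x ∷ xs) = trans
    (cong length (filter-++ P? (f x) (concatMap f xs)))
    (trans (length-++ (filter P? (f x))) (cong (length (filter P? (f x)) +_) (length-filter-concatMap xs)))

module _ {A B : Set} (key : B → A) (f : A → List B) (f-key : ∀ {x y} → y ∈ f x → key y ≡ x) where

  concatMap-unique : (∀ x → Unique (f x)) → ∀ {xs} → Unique xs → Unique (concatMap f xs)
  concatMap-unique f! {[]}     _            = []
  concatMap-unique f! {x ∷ xs} (x∉xs ∷ xs!) = ++⁺ (f! x) (concatMap-unique f! xs!) disjoint
    where
    disjoint : Disjoint (f x) (concatMap f xs)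
    disjoint (y∈fx , y∈fxs) = All.lookupWith
      (λ x≢z y∈fz → x≢z (trans (sym (f-key y∈fx)) (f-key y∈fz))) x∉xs (∈-concatMap⁻ f y∈fxs)

whenT : ∀ {a} {A : Set a} (b : Bool) → (T b → A) → List A
whenT true  g = g _ ∷ []
whenT false g = []

module _ {a} {A : Set a} where

  ∈-whenT⁺ : ∀ {b} (g : T b → A) (p : T b) → g p ∈ whenT b g
  ∈-whenT⁺ {true} g _ = here refl

  ∈-whenT⁻ : ∀ {b} (g : T b → A) {y} → y ∈ whenT b g → ∃ λ p → y ≡ g p
  ∈-whenT⁻ {true} g (here y≡g) = _ , y≡g

  whenT-unique : ∀ {b} (g : T b → A) → Unique (whenT b g)
  whenT-unique {true}  g = [] ∷ []
  whenT-unique {false} g = []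

module _ {A : Set} (f : A → ℕ) where

  sum-map-pos : ∀ xs → 0 < sum (map f xs) → ∃ λ x → 0 < f x
  sum-map-pos (x ∷ xs) 0<Σ with f x in fx
  ... | zero  = sum-map-pos xs 0<Σ
  ... | suc _ = x , subst (0 <_) (sym fx) z<s

  ≤-sum-map : ∀ {x xs} → x ∈ xs → f x ≤ sum (map f xs)
  ≤-sum-map {xs = y ∷ xs} (here refl) = m≤m+n (f y) _
  ≤-sum-map {xs = y ∷ xs} (there x∈)  = ≤-trans (≤-sum-map x∈) (m≤n+m _ (f y))

dec-true⁻ : ∀ {p} {P : Set p} (P? : Dec P) → does P? ≡ true → P
dec-true⁻ (yes p) _ = p

b2n≤1 : ∀ b → b2n b ≤ 1
b2n≤1 true  = s≤s z≤n
b2n≤1 false = z≤n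

b2n-+≤1 : ∀ p q → (p ≡ true → q ≡ true → ⊥) → b2n p + b2n q ≤ 1
b2n-+≤1 true  true  h with () ← h refl refl
b2n-+≤1 true  false _ = s≤s z≤n
b2n-+≤1 false q     _ = b2n≤1 q

Three⇒middle : ∀ {p q r} → Three p q r → p ≡ 1 → r ≡ 1 → q ≤ 1 → q ≡ 1
Three⇒middle {q = zero}        (_ , s≤s () , _) refl refl _
Three⇒middle {q = suc zero}    _                _    _    _        = refl
Three⇒middle {q = suc (suc _)} _                _    _    (s≤s ())

Three-b2n : ∀ p q r → (p ≡ true → q ≡ true → r ≡ true) → (p ≡ true → r ≡ true → q ≡ true) →
  (q ≡ true → r ≡ true → p ≡ true) → Three (b2n p) (b2n q) (b2n r)
Three-b2n true  true  true  _ _ _ = s≤s (s≤s z≤n) , s≤s (s≤s z≤n) , s≤s (s≤s z≤n)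
Three-b2n true  true  false h _ _ with () ← h refl refl
Three-b2n true  false true  _ h _ with () ← h refl refl
Three-b2n false true  true  _ _ h with () ← h refl refl
Three-b2n true  false false _ _ _ = s≤s z≤n , s≤s z≤n , z≤n
Three-b2n false true  false _ _ _ = s≤s z≤n , z≤n , s≤s z≤n
Three-b2n false false true  _ _ _ = z≤n , s≤s z≤n , s≤s z≤n
Three-b2n false false false _ _ _ = z≤n , z≤n , z≤n

<ᶠ⇒< : ∀ {n} (u v : Fin n) → u <ᶠ v ≡ true → toℕ u < toℕ v
<ᶠ⇒< u v u<v = <ᵇ⇒< (toℕ u) (toℕ v) (Equivalence.from T-≡ u<v)

≮ᶠ⇒≮ : ∀ {n} (u v : Fin n) → u <ᶠ v ≡ false → ¬ toℕ u < toℕ v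
≮ᶠ⇒≮ u v u≮v u<v = subst T u≮v (<⇒<ᵇ u<v)

val-sym : ∀ {m n} (x : Vars m n) a i {j k} → j ≢ k → val x a i j k ≡ val x a i k j
val-sym x a i {j} {k} j≢k with j <ᶠ k in j<k | k <ᶠ j in k<j
... | true  | true  = ⊥-elim (<-asym (<ᶠ⇒< j k j<k) (<ᶠ⇒< k j k<j))
... | true  | false = refl
... | false | true  = refl
... | false | false =
  ⊥-elim (j≢k (toℕ-injective (≤-antisym (≮⇒≥ (≮ᶠ⇒≮ k j k<j)) (≮⇒≥ (≮ᶠ⇒≮ j k j<k)))))

-- Defs keeps the counter behind card private; card on the graph with vertices 0, 1 and an edge
-- iff b evaluates to that counter applied to b, plus 0 plus 0.
private
  K₂ : Bool → Graph 2
  K₂ b = record { adj = edge ; adj-sym = edge-sym ; adj-irr = edge-irr }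
    where
    edge : Fin 2 → Fin 2 → Bool
    edge Fin.zero (Fin.suc Fin.zero) = b
    edge (Fin.suc Fin.zero) Fin.zero = b
    edge _ _ = false
    edge-sym : ∀ i j → edge i j ≡ edge j i
    edge-sym Fin.zero           Fin.zero           = refl
    edge-sym Fin.zero           (Fin.suc Fin.zero) = refl
    edge-sym (Fin.suc Fin.zero) Fin.zero           = refl
    edge-sym (Fin.suc Fin.zero) (Fin.suc Fin.zero) = refl
    edge-irr : ∀ i → edge i i ≡ false
    edge-irr Fin.zero           = refl
    edge-irr (Fin.suc Fin.zero) = refl

  onlyEdge : (b : Bool) → (T b → Bool) → OnGraph.ESubset (K₂ b)
  onlyEdge b h (Fin.zero , Fin.suc Fin.zero , p) = h p
  onlyEdge b h _ = false

  cellCount : (b : Bool) → (T b → Bool) → ℕ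
  cellCount b h = OnGraph.card (K₂ b) (onlyEdge b h)

  length-filter-whenT : ∀ {a} {A : Set a} (S : A → Bool) b (g : T b → A) →
    length (filter (λ y → S y Bool.≟ true) (whenT b g)) ≡ cellCount b (S ∘ g)
  length-filter-whenT S false g = refl
  length-filter-whenT S true  g with S (g _)
  ... | true  = refl
  ... | false = refl

module _ {n} (G : Graph n) where
  open OnGraph G

  _≟ᴱ_ : DecidableEquality (Edge G)
  _≟ᴱ_ = ≡-dec Fin._≟_ (≡-dec Fin._≟_ (λ p q → yes (T-irrelevant p q)))

  isEdge : Fin n → Fin n → Bool
  isEdge i j = (i <ᶠ j) ∧ adj G i j

  cell : Fin n → Fin n → List (Edge G)
  cell i j = whenT (isEdge i j) (λ p → i , j , p)

  row : Fin n → List (Edge G)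
  row i = concatMap (cell i) (allFin n)

  edges : List (Edge G)
  edges = concatMap row (allFin n)

  ∈-edges : ∀ e → e ∈ edges
  ∈-edges (i , j , p) =
    ∈-concatMap⁺ row (lose (∈-allFin i) (∈-concatMap⁺ (cell i) (lose (∈-allFin j) (∈-whenT⁺ _ p))))

  ∈-cell⁻ : ∀ {i j e} → e ∈ cell i j → fst e ≡ i × snd e ≡ j
  ∈-cell⁻ e∈ with ∈-whenT⁻ _ e∈
  ... | _ , refl = refl , refl

  edges-unique : Unique edges
  edges-unique = concatMap-unique fst row fst-row row-unique (allFin⁺ n)
    where
    fst-row : ∀ {i e} → e ∈ row i → fst e ≡ i
    fst-row {i} e∈ with Any.satisfied (∈-concatMap⁻ (cell i) {allFin n} e∈)
    ... | _ , e∈cell = proj₁ (∈-cell⁻ e∈cell)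
    row-unique : ∀ i → Unique (row i)
    row-unique i = concatMap-unique snd (cell i) (proj₂ ∘ ∈-cell⁻) (λ _ → whenT-unique _) (allFin⁺ n)

  member? : (S : ESubset) → Decidable (λ e → S e ≡ true)
  member? S e = S e Bool.≟ true

  members : ESubset → List (Edge G)
  members S = filter (member? S) edges

  ∈-members⁺ : ∀ S {d} → S d ≡ true → d ∈ members S
  ∈-members⁺ S {d} d∈S = ∈-filter⁺ (member? S) (∈-edges d) d∈S

  ∈-members⁻ : ∀ S {d} → d ∈ members S → S d ≡ true
  ∈-members⁻ S d∈ = proj₂ (∈-filter⁻ (member? S) {xs = edges} d∈)

  members-unique : ∀ S → Unique (members S)
  members-unique S = filter⁺ (member? S) edges-unique

  card≡length-members : ∀ S → card S ≡ length (members S)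
  card≡length-members S = begin
    card S
      ≡⟨ Σ-cong (λ i → Σ-cong (λ _ → sym (trans (+-identityʳ _) (+-identityʳ _)))) ⟩
    sum (map (λ i → sum (map (λ j → cellCount (isEdge i j) (λ p → S (i , j , p))) (allFin n))) (allFin n))
      ≡⟨ Σ-cong (λ i → Σ-cong (λ j → sym (length-filter-whenT S (isEdge i j) _))) ⟩
    sum (map (λ i → sum (map (λ j → length (filter (member? S) (cell i j))) (allFin n))) (allFin n))
      ≡⟨ Σ-cong (λ i → sym (length-filter-concatMap (member? S) (cell i) (allFin n))) ⟩
    sum (map (λ i → length (filter (member? S) (row i))) (allFin n))
      ≡⟨ sym (length-filter-concatMap (member? S) row (allFin n)) ⟩
    length (members S) ∎
    where
    open ≡-Reasoning
    Σ-cong : ∀ {f g : Fin n → ℕ} → (∀ i → f i ≡ g i) → sum (map f (allFin n)) ≡ sum (map g (allFin n))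
    Σ-cong f≗g = cong sum (map-cong f≗g (allFin n))

  edge-adj : ∀ e → E? G (fst e) (snd e)
  edge-adj (_ , _ , p) = Equivalence.to T-≡ (proj₂ (Equivalence.to T-∧ p))

  edge-< : ∀ e → toℕ (fst e) < toℕ (snd e)
  edge-< (i , j , p) = <ᵇ⇒< (toℕ i) (toℕ j) (proj₁ (Equivalence.to T-∧ p))

  E?-irrefl : ∀ {i} → ¬ E? G i i
  E?-irrefl {i} ii∈E with () ← trans (sym (adj-irr G i)) ii∈E

  data Joins (e : Edge G) : Fin n → Fin n → Set where
    forward  : Joins e (fst e) (snd e)
    backward : Joins e (snd e) (fst e)

  joins? : ∀ e i j → Dec (Joins e i j)
  joins? e i j with fst e Fin.≟ i | snd e Fin.≟ j | fst e Fin.≟ j | snd e Fin.≟ i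
  ... | yes refl | yes refl | _        | _        = yes forward
  ... | _        | _        | yes refl | yes refl = yes backward
  ... | no  ≢i   | _        | no  ≢j   | _        = no λ { forward → ≢i refl ; backward → ≢j refl }
  ... | no  ≢i   | _        | yes _    | no  ≢i′  = no λ { forward → ≢i refl ; backward → ≢i′ refl }
  ... | yes _    | no  ≢j   | no  ≢j′  | _        = no λ { forward → ≢j refl ; backward → ≢j′ refl }
  ... | yes _    | no  ≢j   | yes _    | no  ≢i   = no λ { forward → ≢j refl ; backward → ≢i refl }

  Joins-sym : ∀ {e i j} → Joins e i j → Joins e j i
  Joins-sym forward  = backward
  Joins-sym backward = forward

  Joins⇒E? : ∀ {e i j} → Joins e i j → E? G i j
  Joins⇒E? {e} forward  = edge-adj e
  Joins⇒E? {e} backward = trans (adj-sym G _ _) (edge-adj e)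

  Joins⇒≢ : ∀ {e i j} → Joins e i j → i ≢ j
  Joins⇒≢ e-ij refl = E?-irrefl (Joins⇒E? e-ij)

  Joins-injective : ∀ {e f i j} → Joins e i j → Joins f i j → e ≡ f
  Joins-injective {i , j , p} {.i , .j , q} forward  forward  = cong (λ r → i , j , r) (T-irrelevant p q)
  Joins-injective {i , j , p} {.i , .j , q} backward backward = cong (λ r → i , j , r) (T-irrelevant p q)
  Joins-injective {i , j , p} {.j , .i , q} forward  backward =
    ⊥-elim (<-asym (edge-< (i , j , p)) (edge-< (j , i , q)))
  Joins-injective {i , j , p} {.j , .i , q} backward forward  =
    ⊥-elim (<-asym (edge-< (i , j , p)) (edge-< (j , i , q)))

  Joins-ends : ∀ {e i j k l} → Joins e i j → Joins e k l → (i ≡ k × j ≡ l) ⊎ (i ≡ l × j ≡ k)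
  Joins-ends forward  forward  = inj₁ (refl , refl)
  Joins-ends forward  backward = inj₂ (refl , refl)
  Joins-ends backward forward  = inj₂ (refl , refl)
  Joins-ends backward backward = inj₁ (refl , refl)

  Joins⇒≢ᴱ : ∀ {e f i j k} → Joins e i j → Joins f i k → j ≢ k → e ≢ f
  Joins⇒≢ᴱ e-ij f-ik j≢k refl with Joins-ends e-ij f-ik
  ... | inj₁ (_ , j≡k)  = j≢k j≡k
  ... | inj₂ (_ , refl) = Joins⇒≢ e-ij refl

  edge-between : ∀ {i j} → E? G i j → ∃ λ e → Joins e i j
  edge-between {i} {j} ij∈E with <-cmp i j
  ... | tri< i<j _ _  = (i , j , Equivalence.from T-∧ (<⇒<ᵇ i<j , Equivalence.from T-≡ ij∈E)) , forward
  ... | tri≈ _ refl _ = ⊥-elim (E?-irrefl ij∈E)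
  ... | tri> _ _ j<i  =
    (j , i , Equivalence.from T-∧ (<⇒<ᵇ j<i , Equivalence.from T-≡ (trans (adj-sym G j i) ij∈E))) , backward

  Shares⇒Joins : ∀ {e f} → Shares e f → ∃ λ i → ∃ λ j → ∃ λ k → Joins e i j × Joins f i k
  Shares⇒Joins {_ , _ , _} {_ , _ , _} (inj₁ refl)               = _ , _ , _ , forward  , forward
  Shares⇒Joins {_ , _ , _} {_ , _ , _} (inj₂ (inj₁ refl))        = _ , _ , _ , forward  , backward
  Shares⇒Joins {_ , _ , _} {_ , _ , _} (inj₂ (inj₂ (inj₁ refl))) = _ , _ , _ , backward , forward
  Shares⇒Joins {_ , _ , _} {_ , _ , _} (inj₂ (inj₂ (inj₂ refl))) = _ , _ , _ , backward , backward

  Joins⇒Shares : ∀ {e f i j k} → Joins e i j → Joins f i k → Shares e f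
  Joins⇒Shares {_ , _ , _} {_ , _ , _} forward  forward  = inj₁ refl
  Joins⇒Shares {_ , _ , _} {_ , _ , _} forward  backward = inj₂ (inj₁ refl)
  Joins⇒Shares {_ , _ , _} {_ , _ , _} backward forward  = inj₂ (inj₂ (inj₁ refl))
  Joins⇒Shares {_ , _ , _} {_ , _ , _} backward backward = inj₂ (inj₂ (inj₂ refl))

  Shares-sym : ∀ {e f} → Shares e f → Shares f e
  Shares-sym {e} {f} e~f with _ , _ , _ , e-ij , f-ik ← Shares⇒Joins {e} {f} e~f = Joins⇒Shares f-ik e-ij

  Joins⇒¬Shares : ∀ {e f i j k l} → Joins e i j → Joins f k l →
    i ≢ k → i ≢ l → j ≢ k → j ≢ l → ¬ Shares e f
  Joins⇒¬Shares e-ij f-kl i≢k i≢l j≢k j≢l e~f with _ , _ , _ , e-v , f-v ← Shares⇒Joins e~f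
    with Joins-ends e-v e-ij | Joins-ends f-v f-kl
  ... | inj₁ (refl , _) | inj₁ (refl , _) = i≢k refl
  ... | inj₁ (refl , _) | inj₂ (refl , _) = i≢l refl
  ... | inj₂ (refl , _) | inj₁ (refl , _) = j≢k refl
  ... | inj₂ (refl , _) | inj₂ (refl , _) = j≢l refl

  ｛_｝ : Edge G → ESubset
  ｛ e ｝ d = does (d ≟ᴱ e)

  _∪_ : ESubset → ESubset → ESubset
  (S ∪ T) d = S d ∨ T d

  ends : Fin n → Fin n → ESubset
  ends i j d = does (joins? d i j)

  ∈｛｝ : ∀ e → ｛ e ｝ e ≡ true
  ∈｛｝ e = dec-true (e ≟ᴱ e) refl

  ∈｛｝⁻ : ∀ {e d} → ｛ e ｝ d ≡ true → d ≡ e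
  ∈｛｝⁻ {e} {d} = dec-true⁻ (d ≟ᴱ e)

  ∪⁻ : ∀ S T {d} → (S ∪ T) d ≡ true → S d ≡ true ⊎ T d ≡ true
  ∪⁻ S T {d} d∈ with S d
  ... | true  = inj₁ refl
  ... | false = inj₂ d∈

  ∪⁺ˡ : ∀ S T {d} → S d ≡ true → (S ∪ T) d ≡ true
  ∪⁺ˡ S T d∈S rewrite d∈S = refl

  ∪⁺ʳ : ∀ S T {d} → T d ≡ true → (S ∪ T) d ≡ true
  ∪⁺ʳ S T {d} d∈T rewrite d∈T = ∨-zeroʳ (S d)

  ∪-comm : ∀ S T d → (S ∪ T) d ≡ (T ∪ S) d
  ∪-comm S T d = ∨-comm (S d) (T d)

  ｛｝⊆ : ∀ {e D} → D e ≡ true → ｛ e ｝ ⊆ D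
  ｛｝⊆ {e} e∈D d d∈ with refl ← ∈｛｝⁻ {e} {d} d∈ = e∈D

  ∪⊆ : ∀ {S T D} → S ⊆ D → T ⊆ D → (S ∪ T) ⊆ D
  ∪⊆ {S} {T} S⊆D T⊆D d d∈ with ∪⁻ S T {d} d∈
  ... | inj₁ d∈S = S⊆D d d∈S
  ... | inj₂ d∈T = T⊆D d d∈T

  ends≗｛｝ : ∀ {e i j} → Joins e i j → ∀ d → ends i j d ≡ ｛ e ｝ d
  ends≗｛｝ e-ij d =
    does-⇔ (mk⇔ (λ d-ij → Joins-injective d-ij e-ij) (λ { refl → e-ij })) (joins? d _ _) (d ≟ᴱ _)

  pair-isMatching : ∀ {e f} → ¬ Shares e f → IsMatching (｛ e ｝ ∪ ｛ f ｝)
  pair-isMatching {e} {f} e≁f d d′ d∈ d′∈ d~d′ with ∪⁻ ｛ e ｝ ｛ f ｝ {d} d∈ | ∪⁻ ｛ e ｝ ｛ f ｝ {d′} d′∈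
  ... | inj₁ d∈e | inj₁ d′∈e = trans (∈｛｝⁻ {e} d∈e) (sym (∈｛｝⁻ {e} d′∈e))
  ... | inj₂ d∈f | inj₂ d′∈f = trans (∈｛｝⁻ {f} d∈f) (sym (∈｛｝⁻ {f} d′∈f))
  ... | inj₁ d∈e | inj₂ d′∈f with refl ← ∈｛｝⁻ {e} {d} d∈e | refl ← ∈｛｝⁻ {f} {d′} d′∈f =
    ⊥-elim (e≁f d~d′)
  ... | inj₂ d∈f | inj₁ d′∈e with refl ← ∈｛｝⁻ {f} {d} d∈f | refl ← ∈｛｝⁻ {e} {d′} d′∈e =
    ⊥-elim (e≁f (Shares-sym {d} {d′} d~d′))

  card-｛｝ : ∀ e → card ｛ e ｝ ≤ 1
  card-｛｝ e rewrite card≡length-members ｛ e ｝ =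
    Unique-length-≤ (≡.setoid (Edge G)) {ys = e ∷ []} (members-unique ｛ e ｝)
      (All.tabulate (λ d∈ → here (∈｛｝⁻ {e} (∈-members⁻ ｛ e ｝ d∈))))

  card-pair : ∀ {e f} → e ≢ f → 2 ≤ card (｛ e ｝ ∪ ｛ f ｝)
  card-pair {e} {f} e≢f rewrite card≡length-members (｛ e ｝ ∪ ｛ f ｝) =
    Unique-length-≤ (≡.setoid (Edge G)) ((e≢f ∷ []) ∷ [] ∷ [])
      ( ∈-members⁺ (｛ e ｝ ∪ ｛ f ｝) (∪⁺ˡ ｛ e ｝ ｛ f ｝ {e} (∈｛｝ e))
      ∷ ∈-members⁺ (｛ e ｝ ∪ ｛ f ｝) (∪⁺ʳ ｛ e ｝ ｛ f ｝ {f} (∈｛｝ f))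
      ∷ [])

  -- Matroids

  module _ {ℳ : Family} (ℳ-matroid : IsMatroid ℳ) where
    open IsMatroid ℳ-matroid

    independent-cong : ∀ {S T} → (∀ d → S d ≡ T d) → ℳ S ≡ ℳ T
    independent-cong {S} {T} S≗T = ⇔→≡ {z = true} (mk⇔
      (down-closed T S (λ d d∈T → trans (S≗T d) d∈T))
      (down-closed S T (λ d d∈S → trans (sym (S≗T d)) d∈S)))

    dependent-mono : ∀ {S T} → S ⊆ T → ℳ S ≡ false → ℳ T ≡ false
    dependent-mono {S} {T} S⊆T ℳS with ℳ T in ℳT
    ... | false = refl
    ... | true  = trans (sym (down-closed S T S⊆T ℳT)) ℳS

    maximal-if-pairs-dependent : ∀ {A B} → ℳ B ≡ true → B ⊆ A →
      (∀ d → A d ≡ true → B d ≡ false → ∃ λ x → B x ≡ true × ℳ (｛ x ｝ ∪ ｛ d ｝) ≡ false) →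
      MaximalIn ℳ A B
    maximal-if-pairs-dependent {A} {B} ℳB B⊆A dependent-pair = ℳB , B⊆A , maximal
      where
      maximal : ∀ D → B ⊆ D → D ⊆ A → ℳ D ≡ true → D ⊆ B
      maximal D B⊆D D⊆A ℳD d d∈D with B d in d∈?B
      ... | true  = refl
      ... | false with x , x∈B , xd-dependent ← dependent-pair d (D⊆A d d∈D) d∈?B
        with () ← trans (sym ℳD) (dependent-mono (∪⊆ (｛｝⊆ (B⊆D x x∈B)) (｛｝⊆ d∈D)) xd-dependent)

    module _ (singleton-independent : ∀ e → ℳ ｛ e ｝ ≡ true) where

      dependent-pair-trans : ∀ {e f g} → e ≢ f → e ≢ g → f ≢ g →
        ℳ (｛ e ｝ ∪ ｛ f ｝) ≡ false → ℳ (｛ e ｝ ∪ ｛ g ｝) ≡ false → ℳ (｛ f ｝ ∪ ｛ g ｝) ≡ false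
      dependent-pair-trans {e} {f} {g} e≢f e≢g f≢g ef-dependent eg-dependent
        with ℳ (｛ f ｝ ∪ ｛ g ｝) in fg-independent
      ... | false = refl
      ... | true  = ⊥-elim (<-irrefl refl (begin
            2                      ≤⟨ card-pair f≢g ⟩
            card (｛ f ｝ ∪ ｛ g ｝) ≡⟨ equicard A _ _ fg-maximal e-maximal ⟩
            card ｛ e ｝           ≤⟨ card-｛｝ e ⟩
            1                      ∎))
        where
        open ≤-Reasoning
        A : ESubset
        A = ｛ e ｝ ∪ (｛ f ｝ ∪ ｛ g ｝)

        ∈A⁻ : ∀ d → A d ≡ true → d ≡ e ⊎ d ≡ f ⊎ d ≡ g
        ∈A⁻ d d∈A with ∪⁻ ｛ e ｝ (｛ f ｝ ∪ ｛ g ｝) {d} d∈A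
        ... | inj₁ d∈e = inj₁ (∈｛｝⁻ {e} d∈e)
        ... | inj₂ d∈fg with ∪⁻ ｛ f ｝ ｛ g ｝ {d} d∈fg
        ...   | inj₁ d∈f = inj₂ (inj₁ (∈｛｝⁻ {f} d∈f))
        ...   | inj₂ d∈g = inj₂ (inj₂ (∈｛｝⁻ {g} d∈g))

        f∈fg : (｛ f ｝ ∪ ｛ g ｝) f ≡ true
        f∈fg = ∪⁺ˡ ｛ f ｝ ｛ g ｝ {f} (∈｛｝ f)

        g∈fg : (｛ f ｝ ∪ ｛ g ｝) g ≡ true
        g∈fg = ∪⁺ʳ ｛ f ｝ ｛ g ｝ {g} (∈｛｝ g)

        fg-maximal : MaximalIn ℳ A (｛ f ｝ ∪ ｛ g ｝)
        fg-maximal = maximal-if-pairs-dependent fg-independent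
          (∪⊆ (｛｝⊆ (∪⁺ʳ ｛ e ｝ (｛ f ｝ ∪ ｛ g ｝) {f} f∈fg)) (｛｝⊆ (∪⁺ʳ ｛ e ｝ (｛ f ｝ ∪ ｛ g ｝) {g} g∈fg)))
          extend
          where
          extend : ∀ d → A d ≡ true → (｛ f ｝ ∪ ｛ g ｝) d ≡ false →
            ∃ λ x → (｛ f ｝ ∪ ｛ g ｝) x ≡ true × ℳ (｛ x ｝ ∪ ｛ d ｝) ≡ false
          extend d d∈A d∉fg with ∈A⁻ d d∈A
          ... | inj₁ refl = f , f∈fg , trans (independent-cong (∪-comm ｛ f ｝ ｛ e ｝)) ef-dependent
          ... | inj₂ (inj₁ refl) with () ← trans (sym d∉fg) f∈fg
          ... | inj₂ (inj₂ refl) with () ← trans (sym d∉fg) g∈fg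

        e-maximal : MaximalIn ℳ A ｛ e ｝
        e-maximal = maximal-if-pairs-dependent (singleton-independent e)
          (｛｝⊆ (∪⁺ˡ ｛ e ｝ (｛ f ｝ ∪ ｛ g ｝) {e} (∈｛｝ e))) extend
          where
          extend : ∀ d → A d ≡ true → ｛ e ｝ d ≡ false →
            ∃ λ x → ｛ e ｝ x ≡ true × ℳ (｛ x ｝ ∪ ｛ d ｝) ≡ false
          extend d d∈A d∉e with ∈A⁻ d d∈A
          ... | inj₁ refl with () ← trans (sym d∉e) (∈｛｝ e)
          ... | inj₂ (inj₁ refl) = e , ∈｛｝ e , ef-dependent
          ... | inj₂ (inj₂ refl) = e , ∈｛｝ e , eg-dependent

  module Partition {ℓ} {_~_ : Rel (Edge G) ℓ} (~-isEquivalence : IsEquivalence _~_)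
                   (_~?_ : ∀ e f → Dec (e ~ f)) where
    open IsEquivalence ~-isEquivalence using () renaming (refl to ~-refl; sym to ~-sym)

    ~-setoid : Setoid 0ℓ ℓ
    ~-setoid = record { isEquivalence = ~-isEquivalence }

    Independent : ESubset → Set ℓ
    Independent S = ∀ e f → S e ≡ true → S f ≡ true → e ~ f → e ≡ f

    independent? : ∀ S → Dec (Independent S)
    independent? S = map′
      (λ all e f → All.lookup (All.lookup all (∈-edges e)) (∈-edges f))
      (λ indep → All.tabulate (λ {e} _ → All.tabulate (λ {f} _ → indep e f)))
      (All.all? (λ e → All.all? (λ f →
        member? S e →-dec member? S f →-dec e ~? f →-dec e ≟ᴱ f) edges) edges)

    matroid : Family
    matroid S = does (independent? S)

    covered : ∀ {A B C b} → MaximalIn matroid A B → MaximalIn matroid A C → B b ≡ true →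
      ∃ λ c → C c ≡ true × b ~ c
    covered {A} {B} {C} {b} (_ , B⊆A , _) (C-independent , C⊆A , C-maximal) b∈B
      with Any.any? (λ c → member? C c ×-dec b ~? c) edges
    ... | yes found     = Any.satisfied found
    ... | no  not-found = ⊥-elim (uncovered b∈C ~-refl)
      where
      uncovered : ∀ {c} → C c ≡ true → ¬ b ~ c
      uncovered {c} c∈C b~c = not-found (lose (∈-edges c) (c∈C , b~c))

      C+b-independent : Independent (C ∪ ｛ b ｝)
      C+b-independent e f e∈ f∈ e~f with ∪⁻ C ｛ b ｝ {e} e∈ | ∪⁻ C ｛ b ｝ {f} f∈
      ... | inj₁ e∈C | inj₁ f∈C = dec-true⁻ (independent? C) C-independent e f e∈C f∈C e~f
      ... | inj₁ e∈C | inj₂ f∈b with refl ← ∈｛｝⁻ {b} {f} f∈b = ⊥-elim (uncovered e∈C (~-sym e~f))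
      ... | inj₂ e∈b | inj₁ f∈C with refl ← ∈｛｝⁻ {b} {e} e∈b = ⊥-elim (uncovered f∈C e~f)
      ... | inj₂ e∈b | inj₂ f∈b = trans (∈｛｝⁻ {b} {e} e∈b) (sym (∈｛｝⁻ {b} {f} f∈b))

      b∈C : C b ≡ true
      b∈C = C-maximal (C ∪ ｛ b ｝) (λ d → ∪⁺ˡ C ｛ b ｝ {d}) (∪⊆ C⊆A (｛｝⊆ (B⊆A b b∈B)))
        (dec-true (independent? (C ∪ ｛ b ｝)) C+b-independent) b (∪⁺ʳ C ｛ b ｝ {b} (∈｛｝ b))

    maximal-card-≤ : ∀ {A B C} → MaximalIn matroid A B → MaximalIn matroid A C → card B ≤ card C
    maximal-card-≤ {A} {B} {C} B-maximal C-maximal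
      rewrite card≡length-members B | card≡length-members C =
      Unique-length-≤ ~-setoid
        (Unique⇒Uniqueₛ ~-setoid (members-unique B) λ {e} {f} e∈ f∈ →
          dec-true⁻ (independent? B) (proj₁ B-maximal) e f (∈-members⁻ B e∈) (∈-members⁻ B f∈))
        (All.tabulate λ b∈ → let (c , c∈C , b~c) = covered B-maximal C-maximal (∈-members⁻ B b∈) in
          Any.map (λ { refl → b~c }) (∈-members⁺ C c∈C))

    isMatroid : IsMatroid matroid
    isMatroid = record
      { empty∈      = dec-true (independent? ∅) (λ _ _ ())
      ; down-closed = λ S T S⊆T T-independent → dec-true (independent? S) λ e f e∈S f∈S →
                        dec-true⁻ (independent? T) T-independent e f (S⊆T e e∈S) (S⊆T f f∈S)
      ; equicard    = λ _ _ _ B-maximal C-maximal →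
                        ≤-antisym (maximal-card-≤ B-maximal C-maximal) (maximal-card-≤ C-maximal B-maximal)
      }

  module Free = Partition ≡.isEquivalence _≟ᴱ_

  Free-total : ∀ S → Free.matroid S ≡ true
  Free-total S = dec-true (Free.independent? S) λ _ _ _ _ e≡f → e≡f

  IntersectionOf : ∀ {m} → (Fin m → Family) → Set
  IntersectionOf {m} ℳ = (∀ a → IsMatroid (ℳ a)) × (∀ S → IsMatching S ⇔ (∀ a → ℳ a S ≡ true))

  module _ {k m} (k≤m : k ≤ m) (ℳ : Fin k → Family) where

    pad : Fin m → Family
    pad a with toℕ a <? k
    ... | yes a<k = ℳ (fromℕ< a<k)
    ... | no  _   = Free.matroid

    pad-inject≤ : ∀ a → pad (inject≤ a k≤m) ≡ ℳ a
    pad-inject≤ a with toℕ (inject≤ a k≤m) <? k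
    ... | yes a<k = cong ℳ (trans (fromℕ<-cong _ _ (toℕ-inject≤ a k≤m) a<k (toℕ<n a)) (fromℕ<-toℕ a (toℕ<n a)))
    ... | no  a≮k = ⊥-elim (a≮k (subst (_< k) (sym (toℕ-inject≤ a k≤m)) (toℕ<n a)))

    pad-intersection : IntersectionOf ℳ → IntersectionOf pad
    pad-intersection (ℳ-matroid , matching⇔independent) = pad-matroid , λ S → mk⇔ (to S) (from S)
      where
      pad-matroid : ∀ a → IsMatroid (pad a)
      pad-matroid a with toℕ a <? k
      ... | yes a<k = ℳ-matroid (fromℕ< a<k)
      ... | no  _   = Free.isMatroid

      to : ∀ S → IsMatching S → ∀ a → pad a S ≡ true
      to S S-matching a with toℕ a <? k
      ... | yes a<k = Equivalence.to (matching⇔independent S) S-matching (fromℕ< a<k)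
      ... | no  _   = Free-total S

      from : ∀ S → (∀ a → pad a S ≡ true) → IsMatching S
      from S independent = Equivalence.from (matching⇔independent S) λ a →
        subst (λ M → M S ≡ true) (pad-inject≤ a) (independent (inject≤ a k≤m))

  -- From a solution to matroids

  module MatroidsOfSolution {m} (x : Vars m n)
    (cover : Cover G x) (claw : Claw G x) (triangle : Triangle G x) (matchingC : MatchingC G x) where

    Parallel : Fin m → Edge G → Edge G → Set
    Parallel a e f = ∃ λ i → ∃ λ j → ∃ λ k → Joins e i j × Joins f i k × j ≢ k × val x a i j k ≡ 1

    parallel? : ∀ a e f → Dec (Parallel a e f)
    parallel? a e f = any? λ i → any? λ j → any? λ k →
      joins? e i j ×-dec joins? f i k ×-dec ¬? (j Fin.≟ k) ×-dec val x a i j k ℕ.≟ 1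

    Parallel-sym : ∀ {a e f} → Parallel a e f → Parallel a f e
    Parallel-sym {a} (i , j , k , e-ij , f-ik , j≢k , ijk) =
      i , k , j , f-ik , e-ij , j≢k ∘ sym , trans (val-sym x a i (j≢k ∘ sym)) ijk

    Parallel-trans : ∀ {a e f g} → Parallel a e f → Parallel a f g → e ≡ g ⊎ Parallel a e g
    Parallel-trans {a} (i , j , k , e-ij , f-ik , j≢k , ijk) (_ , _ , l , f-i′k′ , g-i′l , k′≢l , i′k′l)
      with Joins-ends f-ik f-i′k′
    ... | inj₁ (refl , refl) with j Fin.≟ l
    ...   | yes refl = inj₁ (Joins-injective e-ij g-i′l)
    ...   | no  j≢l  = inj₂ (i , j , l , e-ij , g-i′l , j≢l , Three⇒middle
            (claw a i j k l (Joins⇒≢ e-ij) (Joins⇒≢ f-ik) (Joins⇒≢ g-i′l) j≢k j≢l k′≢l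
              (Joins⇒E? e-ij) (Joins⇒E? f-ik) (Joins⇒E? g-i′l))
            ijk i′k′l (b2n≤1 _))
    Parallel-trans {a} (i , j , k , e-ij , f-ik , j≢k , ijk) (_ , _ , l , f-i′k′ , g-kl , i≢l , kil)
        | inj₂ (refl , refl) with l Fin.≟ j
    ...   | yes refl = inj₂ (j , i , k , Joins-sym e-ij , Joins-sym g-kl , Joins⇒≢ f-ik , Three⇒middle
            (triangle a i j k (Joins⇒≢ e-ij) (Joins⇒≢ f-ik) j≢k
              (Joins⇒E? e-ij) (Joins⇒E? f-ik) (Joins⇒E? (Joins-sym g-kl)))
            ijk kil (b2n≤1 _))
    ...   | no  l≢j  with s≤s () ← ≤-trans (subst₂ (λ u v → 2 ≤ u + v) (sym ijk) (sym kil) ≤-refl)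
            (matchingC a i j k l (Joins⇒≢ e-ij) (Joins⇒≢ f-ik) i≢l j≢k (l≢j ∘ sym) (Joins⇒≢ g-kl)
              (Joins⇒E? e-ij) (Joins⇒E? f-ik) (Joins⇒E? g-kl))

    SameClass : Fin m → Edge G → Edge G → Set
    SameClass a e f = e ≡ f ⊎ Parallel a e f

    SameClass-isEquivalence : ∀ a → IsEquivalence (SameClass a)
    SameClass-isEquivalence a = record
      { refl  = inj₁ refl
      ; sym   = λ { (inj₁ refl) → inj₁ refl ; (inj₂ e∥f) → inj₂ (Parallel-sym e∥f) }
      ; trans = λ { (inj₁ refl) f~g → f~g
                  ; (inj₂ e∥f) (inj₁ refl) → inj₂ e∥f
                  ; (inj₂ e∥f) (inj₂ f∥g) → Parallel-trans e∥f f∥g }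
      }

    module Class (a : Fin m) =
      Partition (SameClass-isEquivalence a) (λ e f → e ≟ᴱ f ⊎-dec parallel? a e f)

    positive-term : ∀ {i j k} → 1 ≤ ΣFin m (λ a → val x a i j k) → ∃ λ a → val x a i j k ≡ 1
    positive-term Σ≥1 with a , 0<val ← sum-map-pos _ (allFin m) Σ≥1 = a , ≤-antisym (b2n≤1 _) 0<val

    adjacent⇒Parallel : ∀ {e f i j k} → Joins e i j → Joins f i k → j ≢ k → ∃ λ a → Parallel a e f
    adjacent⇒Parallel {e} {f} {i} {j} {k} e-ij f-ik j≢k with <-cmp j k
    ... | tri< j<k _ _ with a , ijk ← positive-term (cover i j k (Joins⇒E? e-ij) (Joins⇒E? f-ik) j<k) =
      a , i , j , k , e-ij , f-ik , j≢k , ijk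
    ... | tri≈ _ j≡k _ = ⊥-elim (j≢k j≡k)
    ... | tri> _ _ k<j with a , ikj ← positive-term (cover i k j (Joins⇒E? f-ik) (Joins⇒E? e-ij) k<j) =
      a , Parallel-sym (i , k , j , f-ik , e-ij , j≢k ∘ sym , ikj)

    intersection : IntersectionOf Class.matroid
    intersection = Class.isMatroid , λ S → mk⇔ (matching⇒independent S) (independent⇒matching S)
      where
      matching⇒independent : ∀ S → IsMatching S → ∀ a → Class.matroid a S ≡ true
      matching⇒independent S S-matching a = dec-true (Class.independent? a S) λ where
        e f e∈S f∈S (inj₁ e≡f) → e≡f
        e f e∈S f∈S (inj₂ (_ , _ , _ , e-ij , f-ik , _)) → S-matching e f e∈S f∈S (Joins⇒Shares e-ij f-ik)

      independent⇒matching : ∀ S → (∀ a → Class.matroid a S ≡ true) → IsMatching S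
      independent⇒matching S S-independent e f e∈S f∈S e~f
        with _ , j , k , e-ij , f-ik ← Shares⇒Joins e~f
        with j Fin.≟ k
      ... | yes refl = Joins-injective e-ij f-ik
      ... | no  j≢k  with a , e∥f ← adjacent⇒Parallel e-ij f-ik j≢k =
        dec-true⁻ (Class.independent? a S) (S-independent a) e f e∈S f∈S (inj₂ e∥f)

  -- From matroids to a solution

  module SolutionOfMatroids {m} {ℳ : Fin m → Family} (ℳ-intersection : IntersectionOf ℳ) where
    open Σ ℳ-intersection renaming (proj₁ to ℳ-matroid; proj₂ to matching⇔independent)

    singleton-independent : ∀ a e → ℳ a ｛ e ｝ ≡ true
    singleton-independent a e = Equivalence.to (matching⇔independent ｛ e ｝)
      (λ d d′ d∈ d′∈ _ → trans (∈｛｝⁻ {e} d∈) (sym (∈｛｝⁻ {e} d′∈))) a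

    Dependent : Fin m → Edge G → Edge G → Bool
    Dependent a e f = not (ℳ a (｛ e ｝ ∪ ｛ f ｝))

    Dependent-sym : ∀ a e f → Dependent a e f ≡ Dependent a f e
    Dependent-sym a e f = cong not (independent-cong (ℳ-matroid a) (∪-comm ｛ e ｝ ｛ f ｝))

    Dependent-trans : ∀ a {e f g} → e ≢ f → e ≢ g → f ≢ g →
      Dependent a e f ≡ true → Dependent a e g ≡ true → Dependent a f g ≡ true
    Dependent-trans a e≢f e≢g f≢g ef eg = cong not (dependent-pair-trans (ℳ-matroid a)
      (singleton-independent a) e≢f e≢g f≢g (not-injective ef) (not-injective eg))

    Three-Dependent : ∀ a {e f g} → e ≢ f → e ≢ g → f ≢ g →
      Three (b2n (Dependent a e f)) (b2n (Dependent a e g)) (b2n (Dependent a f g))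
    Three-Dependent a {e} {f} {g} e≢f e≢g f≢g = Three-b2n _ _ _
      (Dependent-trans a e≢f e≢g f≢g)
      (λ ef fg → Dependent-trans a (e≢f ∘ sym) f≢g e≢g (trans (Dependent-sym a f e) ef) fg)
      (λ eg fg → Dependent-trans a (e≢g ∘ sym) (f≢g ∘ sym) e≢f
        (trans (Dependent-sym a g e) eg) (trans (Dependent-sym a g f) fg))

    -- ends i j is {ij} when ij ∈ E and empty otherwise, so x needs no adjacency proofs.
    x : Vars m n
    x a i j k = not (ℳ a (ends i j ∪ ends i k))

    val-x : ∀ a {e f i j k} → Joins e i j → Joins f i k → val x a i j k ≡ b2n (Dependent a e f)
    val-x a {e} {f} {i} {j} {k} e-ij f-ik with j <ᶠ k
    ... | true  = cong (b2n ∘ not) (independent-cong (ℳ-matroid a) λ d →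
                    cong₂ _∨_ (ends≗｛｝ e-ij d) (ends≗｛｝ f-ik d))
    ... | false = cong (b2n ∘ not) (independent-cong (ℳ-matroid a) λ d →
                    trans (cong₂ _∨_ (ends≗｛｝ f-ik d) (ends≗｛｝ e-ij d)) (∪-comm ｛ f ｝ ｛ e ｝ d))

    adjacent-not-independent : ∀ {e f i j k} → Joins e i j → Joins f i k → j ≢ k →
      ¬ (∀ a → ℳ a (｛ e ｝ ∪ ｛ f ｝) ≡ true)
    adjacent-not-independent {e} {f} e-ij f-ik j≢k independent = Joins⇒≢ᴱ e-ij f-ik j≢k
      (Equivalence.from (matching⇔independent _) independent e f
        (∪⁺ˡ ｛ e ｝ ｛ f ｝ {e} (∈｛｝ e)) (∪⁺ʳ ｛ e ｝ ｛ f ｝ {f} (∈｛｝ f)) (Joins⇒Shares e-ij f-ik))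

    adjacent⇒Dependent : ∀ {e f i j k} → Joins e i j → Joins f i k → j ≢ k →
      ∃ λ a → Dependent a e f ≡ true
    adjacent⇒Dependent {e} {f} e-ij f-ik j≢k
      with a , ef-dependent ← ¬∀⟶∃¬ m _ (λ a → ℳ a (｛ e ｝ ∪ ｛ f ｝) Bool.≟ true)
                                        (adjacent-not-independent e-ij f-ik j≢k) =
      a , cong not (¬-not ef-dependent)

    x-cover : Cover G x
    x-cover i j k ij∈E ik∈E j<k
      with e , e-ij ← edge-between ij∈E | f , f-ik ← edge-between ik∈E
      with a , ef-dependent ← adjacent⇒Dependent e-ij f-ik (<⇒≢ j<k) =
      subst (_≤ ΣFin m (λ a → val x a i j k)) (trans (val-x a e-ij f-ik) (cong b2n ef-dependent))
        (≤-sum-map (λ a → val x a i j k) (∈-allFin a))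

    x-claw : Claw G x
    x-claw a i j k l _ _ _ j≢k j≢l k≢l ij∈E ik∈E il∈E
      with e , e-ij ← edge-between ij∈E | f , f-ik ← edge-between ik∈E | g , g-il ← edge-between il∈E
      rewrite val-x a e-ij f-ik | val-x a e-ij g-il | val-x a f-ik g-il =
      Three-Dependent a (Joins⇒≢ᴱ e-ij f-ik j≢k) (Joins⇒≢ᴱ e-ij g-il j≢l) (Joins⇒≢ᴱ f-ik g-il k≢l)

    x-triangle : Triangle G x
    x-triangle a i j k i≢j i≢k j≢k ij∈E ik∈E jk∈E
      with e , e-ij ← edge-between ij∈E | f , f-ik ← edge-between ik∈E | g , g-jk ← edge-between jk∈E
      rewrite val-x a e-ij f-ik | val-x a (Joins-sym e-ij) g-jk | val-x a (Joins-sym f-ik) (Joins-sym g-jk) =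
      Three-Dependent a (Joins⇒≢ᴱ e-ij f-ik j≢k) (Joins⇒≢ᴱ (Joins-sym e-ij) g-jk i≢k)
        (Joins⇒≢ᴱ (Joins-sym f-ik) (Joins-sym g-jk) i≢j)

    x-matching : MatchingC G x
    x-matching a i j k l _ i≢k i≢l j≢k j≢l _ ij∈E ik∈E kl∈E
      with e , e-ij ← edge-between ij∈E | f , f-ik ← edge-between ik∈E | g , g-kl ← edge-between kl∈E
      rewrite val-x a e-ij f-ik | val-x a (Joins-sym f-ik) g-kl =
      b2n-+≤1 _ _ λ ef fg → not-¬ eg-independent
        (not-injective (Dependent-trans a f≢e f≢g e≢g (trans (Dependent-sym a f e) ef) fg))
      where
      e≁g : ¬ Shares e g
      e≁g = Joins⇒¬Shares e-ij g-kl i≢k i≢l j≢k j≢l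
      e≢g : e ≢ g
      e≢g refl = e≁g (inj₁ refl)
      f≢e : f ≢ e
      f≢e = Joins⇒≢ᴱ f-ik e-ij (j≢k ∘ sym)
      f≢g : f ≢ g
      f≢g = Joins⇒≢ᴱ (Joins-sym f-ik) g-kl i≢l
      eg-independent : ℳ a (｛ e ｝ ∪ ｛ g ｝) ≡ true
      eg-independent = Equivalence.to (matching⇔independent _) (pair-isMatching e≁g) a

theorem3 : ∀ {n} (G : Graph n) (m : ℕ) → 1 ≤ m →
    IntersectionOfAtMost G m ⇔
    Σ (Vars m n) (λ x → Cover G x × Claw G x × Triangle G x × MatchingC G x)
theorem3 G m _ = mk⇔
  (λ (k , k≤m , ℳ , ℳ-intersection) →
    let open SolutionOfMatroids G (pad-intersection G k≤m ℳ ℳ-intersection) in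
    x , x-cover , x-claw , x-triangle , x-matching)
  (λ (x , cover , claw , triangle , matchingC) →
    m , ≤-refl , _ , MatroidsOfSolution.intersection G x cover claw triangle matchingC)
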